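{- For every integer $n\ge 2$, $$ \sum_{j=1}^{n-1}B_j B_{n-j}=\sum_{m=0}^{\lfloor (n-1)/2\rfloor}(n-2 m-1)B_{n-2 m-1}\,. $$
   Context: The balancing numbers $B_n$ are defined by $B_0=0$, $B_1=1$ and $B_n=6B_{n-1}-B_{n-2}$ for $n\ge 2$. -}

module Defs where

open import Data.Nat using (ℕ; zero; suc; _+_; _∸_)
open import Data.Integer using (ℤ; +_; _-_; _*_)
import Data.Integer as ℤ

B : ℕ → ℤ
B zero = + 0
B (suc zero) = + 1
B (suc (suc n)) = + 6 * B (suc n) - B n

-- Σ[ a ≤ i ≤ b ] f i  (empty when b < a):  sumFromTo a b f = f a + … + f b
sumFromTo : ℕ → ℕ → (ℕ → ℤ) → ℤ
sumFromTo a b f = go a (suc b ∸ a)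
  where
  go : ℕ → ℕ → ℤ
  go i zero = + 0
  go i (suc k) = f i ℤ.+ go (suc i) k

module Submission where

open import Defs
open import Data.Nat using (ℕ; _≤_; _∸_; _*_; _/_)
open import Data.Integer using (ℤ; +_)
import Data.Integer as ℤ
open import Relation.Binary.PropositionalEquality using (_≡_)

open import Data.Nat using (zero; suc; _+_; z≤n; s≤s)
open import Data.Nat.Properties using (+-suc; +-identityʳ; +-∸-assoc; ≤-refl; m≤m+n; n∸n≡0; *-suc)
open import Data.Nat.DivMod using (m/n≡1+[m∸n]/n)
open import Data.Product using (_×_; _,_; proj₁)
open import Relation.Binary.PropositionalEquality
  using (refl; sym; trans; cong; cong₂; module ≡-Reasoning)
open import Data.Integer.Tactic.RingSolver using (solve-∀)
import Data.Integer.Properties as ℤP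

-- Write C n = Σ_{i=0}^{n} B_{n-i} B_i for the self-convolution of
-- the balancing numbers and W n = (n+1) B_{n+1}.  The theorem says that the
-- interior sum (terms j = 1 … n-1) of C n equals the right-hand side R n, and
-- since B_0 = 0 the interior sum is all of C n.
--   1. Shifting the second factor of the convolution gives sums that obey
--      the balancing recurrence in the shift, whence
--      C (n+2) = 6 C (n+1) - C n + B_{n+1}.
--   2. Both C (n+2) - C n and W n satisfy the inhomogeneous recurrence
--      u (n+2) = 6 u (n+1) - u n + (B_{n+3} - B_{n+1}) and agree for n = 0, 1,
--      so C (n+2) = C n + W n.
--   3. Peeling off the first term of R (n+2) gives R (n+2) = R n + W n.
--   4. C and R agree at 0 and 1, so C = R; the theorem follows.
-- Steps 2 and 4 both use that a second-order recurrence determines a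
-- sequence from its first two values.

open ≡-Reasoning

recurrence-unique : {A : Set} (step : ℕ → A → A → A) {u v : ℕ → A} →
  (∀ n → u (suc (suc n)) ≡ step n (u (suc n)) (u n)) →
  (∀ n → v (suc (suc n)) ≡ step n (v (suc n)) (v n)) →
  u 0 ≡ v 0 → u 1 ≡ v 1 → ∀ n → u n ≡ v n
recurrence-unique step {u} {v} u-rec v-rec u₀≡v₀ u₁≡v₁ n = proj₁ (agree n)
  where
  agree : ∀ n → u n ≡ v n × u (suc n) ≡ v (suc n)
  agree zero = u₀≡v₀ , u₁≡v₁
  agree (suc n) =
    let (uₙ≡vₙ , uₙ₊₁≡vₙ₊₁) = agree n
    in uₙ₊₁≡vₙ₊₁ , (begin
         u (suc (suc n))             ≡⟨ u-rec n ⟩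
         step n (u (suc n)) (u n)    ≡⟨ cong₂ (step n) uₙ₊₁≡vₙ₊₁ uₙ≡vₙ ⟩
         step n (v (suc n)) (v n)    ≡⟨ sym (v-rec n) ⟩
         v (suc (suc n))             ∎)

sumFrom : (ℕ → ℤ) → ℕ → ℕ → ℤ
sumFrom f i zero = + 0
sumFrom f i (suc k) = f i ℤ.+ sumFrom f (suc i) k

sumFrom-cong : ∀ f g → (∀ i → f i ≡ g i) → ∀ i k → sumFrom f i k ≡ sumFrom g i k
sumFrom-cong f g f≗g i zero = refl
sumFrom-cong f g f≗g i (suc k) = cong₂ ℤ._+_ (f≗g i) (sumFrom-cong f g f≗g (suc i) k)

sumFrom-shift : ∀ f i k → sumFrom f (suc i) k ≡ sumFrom (λ j → f (suc j)) i k
sumFrom-shift f i zero = refl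
sumFrom-shift f i (suc k) = cong (λ s → f (suc i) ℤ.+ s) (sumFrom-shift f (suc i) k)

sumFrom-snoc : ∀ f i k → sumFrom f i (suc k) ≡ sumFrom f i k ℤ.+ f (i + k)
sumFrom-snoc f i zero = begin
  f i ℤ.+ + 0    ≡⟨ ℤP.+-comm (f i) (+ 0) ⟩
  + 0 ℤ.+ f i    ≡⟨ cong (λ j → + 0 ℤ.+ f j) (sym (+-identityʳ i)) ⟩
  + 0 ℤ.+ f (i + 0) ∎
sumFrom-snoc f i (suc k) = begin
  f i ℤ.+ sumFrom f (suc i) (suc k)
    ≡⟨ cong (λ s → f i ℤ.+ s) (sumFrom-snoc f (suc i) k) ⟩
  f i ℤ.+ (sumFrom f (suc i) k ℤ.+ f (suc i + k))
    ≡⟨ sym (ℤP.+-assoc (f i) _ _) ⟩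
  f i ℤ.+ sumFrom f (suc i) k ℤ.+ f (suc (i + k))
    ≡⟨ cong (λ j → f i ℤ.+ sumFrom f (suc i) k ℤ.+ f j) (sym (+-suc i k)) ⟩
  f i ℤ.+ sumFrom f (suc i) k ℤ.+ f (i + suc k) ∎

sumFrom-combine : ∀ c f g h → (∀ i → f i ≡ c ℤ.* g i ℤ.- h i) →
  ∀ i k → sumFrom f i k ≡ c ℤ.* sumFrom g i k ℤ.- sumFrom h i k
sumFrom-combine c f g h f≡cg-h i zero = sym (trans (ℤP.+-identityʳ (c ℤ.* + 0)) (ℤP.*-zeroʳ c))
sumFrom-combine c f g h f≡cg-h i (suc k) = begin
  f i ℤ.+ sumFrom f (suc i) k
    ≡⟨ cong₂ ℤ._+_ (f≡cg-h i) (sumFrom-combine c f g h f≡cg-h (suc i) k) ⟩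
  (c ℤ.* g i ℤ.- h i) ℤ.+ (c ℤ.* sumFrom g (suc i) k ℤ.- sumFrom h (suc i) k)
    ≡⟨ regroup c (g i) (h i) (sumFrom g (suc i) k) (sumFrom h (suc i) k) ⟩
  c ℤ.* (g i ℤ.+ sumFrom g (suc i) k) ℤ.- (h i ℤ.+ sumFrom h (suc i) k) ∎
  where
  regroup : ∀ c x y s t → (c ℤ.* x ℤ.- y) ℤ.+ (c ℤ.* s ℤ.- t) ≡ c ℤ.* (x ℤ.+ s) ℤ.- (y ℤ.+ t)
  regroup = solve-∀

sumFromTo-cons : ∀ a b f → a ≤ b → sumFromTo a b f ≡ f a ℤ.+ sumFromTo (suc a) b f
sumFromTo-cons a b f a≤b rewrite +-∸-assoc 1 a≤b = refl

sumFromTo-empty : ∀ a f → sumFromTo (suc a) a f ≡ + 0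
sumFromTo-empty a f rewrite n∸n≡0 a = refl

sumFromTo-range : ∀ a k f → sumFromTo a (a + k) f ≡ sumFrom f a (suc k)
sumFromTo-range a zero f rewrite +-identityʳ a =
  trans (sumFromTo-cons a a f ≤-refl) (cong (λ s → f a ℤ.+ s) (sumFromTo-empty a f))
sumFromTo-range a (suc k) f = begin
  sumFromTo a (a + suc k) f
    ≡⟨ sumFromTo-cons a (a + suc k) f (m≤m+n a (suc k)) ⟩
  f a ℤ.+ sumFromTo (suc a) (a + suc k) f
    ≡⟨ cong (λ b → f a ℤ.+ sumFromTo (suc a) b f) (+-suc a k) ⟩
  f a ℤ.+ sumFromTo (suc a) (suc a + k) f
    ≡⟨ cong (λ s → f a ℤ.+ s) (sumFromTo-range (suc a) k f) ⟩
  f a ℤ.+ sumFrom f (suc a) (suc k) ∎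

shiftedConv : ℕ → ℕ → ℤ
shiftedConv n m = sumFrom (λ i → B (n ∸ i) ℤ.* B (m + i)) 0 (suc n)

conv : ℕ → ℤ
conv n = shiftedConv n 0

-- Each term, hence the sum, obeys the balancing recurrence in the shift m.
shiftedConv-rec : ∀ n m →
  shiftedConv n (suc (suc m)) ≡ + 6 ℤ.* shiftedConv n (suc m) ℤ.- shiftedConv n m
shiftedConv-rec n m = sumFrom-combine (+ 6) (term (2 + m)) (term (1 + m)) (term m)
  (λ i → distrib (B (n ∸ i)) (B (suc (m + i))) (B (m + i))) 0 (suc n)
  where
  term : ℕ → ℕ → ℤ
  term j i = B (n ∸ i) ℤ.* B (j + i)
  distrib : ∀ a x y → a ℤ.* (+ 6 ℤ.* x ℤ.- y) ≡ + 6 ℤ.* (a ℤ.* x) ℤ.- a ℤ.* y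
  distrib = solve-∀

shiftedConv-peel : ∀ n m →
  shiftedConv (suc n) m ≡ B (suc n) ℤ.* B (m + 0) ℤ.+ shiftedConv n (suc m)
shiftedConv-peel n m = cong (λ s → B (suc n) ℤ.* B (m + 0) ℤ.+ s) (begin
  sumFrom (λ i → B (suc n ∸ i) ℤ.* B (m + i)) 1 (suc n)
    ≡⟨ sumFrom-shift (λ i → B (suc n ∸ i) ℤ.* B (m + i)) 0 (suc n) ⟩
  sumFrom (λ i → B (n ∸ i) ℤ.* B (m + suc i)) 0 (suc n)
    ≡⟨ sumFrom-cong _ _ (λ i → cong (λ j → B (n ∸ i) ℤ.* B j) (+-suc m i)) 0 (suc n) ⟩
  sumFrom (λ i → B (n ∸ i) ℤ.* B (suc m + i)) 0 (suc n) ∎)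

conv-rec : ∀ n → conv (suc (suc n)) ≡ + 6 ℤ.* conv (suc n) ℤ.- conv n ℤ.+ B (suc n)
conv-rec n = begin
  conv (suc (suc n))
    ≡⟨ shiftedConv-peel (suc n) 0 ⟩
  B (suc (suc n)) ℤ.* + 0 ℤ.+ shiftedConv (suc n) 1
    ≡⟨ cong (λ s → B (suc (suc n)) ℤ.* + 0 ℤ.+ s) (shiftedConv-peel n 1) ⟩
  B (suc (suc n)) ℤ.* + 0 ℤ.+ (B (suc n) ℤ.* + 1 ℤ.+ shiftedConv n 2)
    ≡⟨ cong (λ s → B (suc (suc n)) ℤ.* + 0 ℤ.+ (B (suc n) ℤ.* + 1 ℤ.+ s)) (shiftedConv-rec n 0) ⟩
  B (suc (suc n)) ℤ.* + 0 ℤ.+ (B (suc n) ℤ.* + 1 ℤ.+ (+ 6 ℤ.* shiftedConv n 1 ℤ.- conv n))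
    ≡⟨ collect (B (suc (suc n))) (B (suc n)) (shiftedConv n 1) (conv n) ⟩
  + 6 ℤ.* (B (suc n) ℤ.* + 0 ℤ.+ shiftedConv n 1) ℤ.- conv n ℤ.+ B (suc n)
    ≡⟨ cong (λ c → + 6 ℤ.* c ℤ.- conv n ℤ.+ B (suc n)) (sym (shiftedConv-peel n 0)) ⟩
  + 6 ℤ.* conv (suc n) ℤ.- conv n ℤ.+ B (suc n) ∎
  where
  collect : ∀ b₂ b₁ s c₀ →
    b₂ ℤ.* + 0 ℤ.+ (b₁ ℤ.* + 1 ℤ.+ (+ 6 ℤ.* s ℤ.- c₀)) ≡ + 6 ℤ.* (b₁ ℤ.* + 0 ℤ.+ s) ℤ.- c₀ ℤ.+ b₁
  collect = solve-∀

diffStep : ℕ → ℤ → ℤ → ℤ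
diffStep n u₁ u₀ = + 6 ℤ.* u₁ ℤ.- u₀ ℤ.+ (B (3 + n) ℤ.- B (suc n))

weightedB : ℕ → ℤ
weightedB n = + suc n ℤ.* B (suc n)

weightedB-rec : ∀ n → weightedB (suc (suc n)) ≡ diffStep n (weightedB (suc n)) (weightedB n)
weightedB-rec n = expand (+ suc n) (B (suc n)) (B (suc (suc n)))
  where
  expand : ∀ k b₁ b₂ → (+ 1 ℤ.+ (+ 1 ℤ.+ k)) ℤ.* (+ 6 ℤ.* b₂ ℤ.- b₁)
    ≡ + 6 ℤ.* ((+ 1 ℤ.+ k) ℤ.* b₂) ℤ.- k ℤ.* b₁ ℤ.+ ((+ 6 ℤ.* b₂ ℤ.- b₁) ℤ.- b₁)
  expand = solve-∀

convDiff : ℕ → ℤ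
convDiff n = conv (suc (suc n)) ℤ.- conv n

convDiff-rec : ∀ n → convDiff (suc (suc n)) ≡ diffStep n (convDiff (suc n)) (convDiff n)
convDiff-rec n = begin
  c₄ ℤ.- c₂
    ≡⟨ cong (λ c → c ℤ.- c₂) (conv-rec (suc (suc n))) ⟩
  + 6 ℤ.* c₃ ℤ.- c₂ ℤ.+ B (3 + n) ℤ.- c₂
    ≡⟨ cong (λ c → + 6 ℤ.* c₃ ℤ.- c₂ ℤ.+ B (3 + n) ℤ.- c) (conv-rec n) ⟩
  + 6 ℤ.* c₃ ℤ.- c₂ ℤ.+ B (3 + n) ℤ.- (+ 6 ℤ.* c₁ ℤ.- c₀ ℤ.+ B (suc n))
    ≡⟨ regroup c₀ c₁ c₂ c₃ (B (suc n)) (B (3 + n)) ⟩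
  + 6 ℤ.* (c₃ ℤ.- c₁) ℤ.- (c₂ ℤ.- c₀) ℤ.+ (B (3 + n) ℤ.- B (suc n)) ∎
  where
  c₀ = conv n
  c₁ = conv (suc n)
  c₂ = conv (suc (suc n))
  c₃ = conv (3 + n)
  c₄ = conv (4 + n)
  regroup : ∀ c₀ c₁ c₂ c₃ b₁ b₃ →
    + 6 ℤ.* c₃ ℤ.- c₂ ℤ.+ b₃ ℤ.- (+ 6 ℤ.* c₁ ℤ.- c₀ ℤ.+ b₁)
    ≡ + 6 ℤ.* (c₃ ℤ.- c₁) ℤ.- (c₂ ℤ.- c₀) ℤ.+ (b₃ ℤ.- b₁)
  regroup = solve-∀

conv-step : ∀ n → conv (suc (suc n)) ≡ conv n ℤ.+ weightedB n
conv-step n = begin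
  conv (suc (suc n))            ≡⟨ split (conv (suc (suc n))) (conv n) ⟩
  conv n ℤ.+ convDiff n         ≡⟨ cong (λ s → conv n ℤ.+ s) (convDiff≡weightedB n) ⟩
  conv n ℤ.+ weightedB n        ∎
  where
  split : ∀ a b → a ≡ b ℤ.+ (a ℤ.- b)
  split = solve-∀
  convDiff≡weightedB : ∀ n → convDiff n ≡ weightedB n
  convDiff≡weightedB = recurrence-unique diffStep {convDiff} {weightedB}
    convDiff-rec weightedB-rec refl refl

parityTerm : ℕ → ℕ → ℤ
parityTerm n m = + (n ∸ 2 * m ∸ 1) ℤ.* B (n ∸ 2 * m ∸ 1)

paritySum : ℕ → ℤ
paritySum n = sumFromTo 0 ((n ∸ 1) / 2) (parityTerm n)

parityTerm-shift : ∀ n m → parityTerm (suc (suc n)) (suc m) ≡ parityTerm n m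
parityTerm-shift n m = cong (λ t → + (t ∸ 1) ℤ.* B (t ∸ 1)) (cong (suc (suc n) ∸_) (*-suc 2 m))

-- Step 3: the first term of paritySum (n+2) is (n+1) B_{n+1}; the rest is paritySum n.
paritySum-step : ∀ n → paritySum (suc (suc n)) ≡ paritySum n ℤ.+ weightedB n
paritySum-step zero = refl
paritySum-step (suc k) = begin
  paritySum (3 + k)
    ≡⟨ sumFromTo-range 0 (suc (suc k) / 2) (parityTerm (3 + k)) ⟩
  sumFrom (parityTerm (3 + k)) 0 (suc (suc (suc k) / 2))
    ≡⟨ cong (λ q → sumFrom (parityTerm (3 + k)) 0 (suc q))
            (m/n≡1+[m∸n]/n {suc (suc k)} {2} (s≤s (s≤s z≤n))) ⟩
  weightedB (suc k) ℤ.+ sumFrom (parityTerm (3 + k)) 1 (suc (k / 2))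
    ≡⟨ cong (λ s → weightedB (suc k) ℤ.+ s) drop-first ⟩
  weightedB (suc k) ℤ.+ sumFrom (parityTerm (suc k)) 0 (suc (k / 2))
    ≡⟨ ℤP.+-comm (weightedB (suc k)) _ ⟩
  sumFrom (parityTerm (suc k)) 0 (suc (k / 2)) ℤ.+ weightedB (suc k)
    ≡⟨ cong (λ s → s ℤ.+ weightedB (suc k)) (sym (sumFromTo-range 0 (k / 2) (parityTerm (suc k)))) ⟩
  paritySum (suc k) ℤ.+ weightedB (suc k) ∎
  where
  drop-first : sumFrom (parityTerm (3 + k)) 1 (suc (k / 2)) ≡ sumFrom (parityTerm (suc k)) 0 (suc (k / 2))
  drop-first = trans (sumFrom-shift (parityTerm (3 + k)) 0 (suc (k / 2)))
                     (sumFrom-cong _ _ (parityTerm-shift (suc k)) 0 (suc (k / 2)))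

conv≡paritySum : ∀ n → conv n ≡ paritySum n
conv≡paritySum = recurrence-unique (λ n _ s → s ℤ.+ weightedB n) {conv} {paritySum}
  conv-step paritySum-step refl refl

-- Since B_0 = 0, the first and last terms of the convolution vanish.
conv-interior : ∀ m →
  sumFrom (λ j → B j ℤ.* B (suc (suc m) ∸ j)) 1 (suc m) ≡ conv (suc (suc m))
conv-interior m = sym (begin
  conv n
    ≡⟨ cong (λ s → h 0 ℤ.+ s) (sumFrom-snoc h 1 (suc m)) ⟩
  h 0 ℤ.+ (sumFrom h 1 (suc m) ℤ.+ h n)
    ≡⟨ cong₂ (λ x y → x ℤ.+ (sumFrom h 1 (suc m) ℤ.+ y)) (ℤP.*-zeroʳ (B n)) last-vanishes ⟩
  + 0 ℤ.+ (sumFrom h 1 (suc m) ℤ.+ + 0)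
    ≡⟨ trans (ℤP.+-identityˡ _) (ℤP.+-identityʳ _) ⟩
  sumFrom h 1 (suc m)
    ≡⟨ sumFrom-cong _ _ (λ j → ℤP.*-comm (B (n ∸ j)) (B j)) 1 (suc m) ⟩
  sumFrom (λ j → B j ℤ.* B (n ∸ j)) 1 (suc m) ∎)
  where
  n = suc (suc m)
  h : ℕ → ℤ
  h i = B (n ∸ i) ℤ.* B (0 + i)
  last-vanishes : h n ≡ + 0
  last-vanishes = trans (cong (λ k → B k ℤ.* B n) (n∸n≡0 m)) (ℤP.*-zeroˡ (B n))

theorem4 : (n : ℕ) → 2 ≤ n →
    sumFromTo 1 (n ∸ 1) (λ j → B j ℤ.* B (n ∸ j))
      ≡ sumFromTo 0 ((n ∸ 1) / 2) (λ m → + (n ∸ 2 * m ∸ 1) ℤ.* B (n ∸ 2 * m ∸ 1))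
theorem4 (suc (suc m)) (s≤s (s≤s z≤n)) = begin
  sumFromTo 1 (1 + m) f       ≡⟨ sumFromTo-range 1 m f ⟩
  sumFrom f 1 (suc m)         ≡⟨ conv-interior m ⟩
  conv (suc (suc m))          ≡⟨ conv≡paritySum (suc (suc m)) ⟩
  paritySum (suc (suc m))     ∎
  where
  f : ℕ → ℤ
  f j = B j ℤ.* B (suc (suc m) ∸ j)
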